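{- Let $R$ be an associative ring with unity and let $\mathbf{K}=(K,\leq_p)$ and $\mathbf{K}^\star=(K^\star,\leq_p)$ be abstract elementary classes with $K,K^\star$ classes of left $R$-modules such that $\mathbf{K}^\star$ is closed below $\mathbf{K}$. Then $\mathbf{K}^\star$ admits intersections. Moreover, for every $N\in K^\star$ and $A\subseteq N$, $cl^N_{\mathbf{K}}(A)=cl^N_{\mathbf{K}^\star}(A)$.
   Context: $\leq_p$: pure submodule relation. An AEC $\mathbf{K}$ of modules with $\leq_p$ admits intersections if for every $N\in K$ and $A\subseteq N$, $cl^N_{\mathbf{K}}(A):=\bigcap\{M\in K: M\leq_p N, A\subseteq M\}$ belongs to $K$ and $cl^N_{\mathbf{K}}(A)\leq_p N$. $\mathbf{K}^\star$ is closed below $\mathbf{K}$ if $K^\star\subseteq K$, both $K$ and $K^\star$ are closed under pure submodules, and $\mathbf{K}$ admits intersections. -}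

module Defs where

open import Level using (Level; _⊔_) renaming (suc to lsuc)
open import Algebra.Bundles using (Ring)
open import Algebra.Module.Bundles using (LeftModule)
open import Algebra.Module.Morphism.Structures
  using (module LeftModuleMorphisms)
import Algebra.Module.Morphism.LeftModuleMonomorphism as LMM
open import Data.Nat using (ℕ; zero; suc)
open import Data.Fin using (Fin; zero; suc)
open import Data.Product using (Σ; _×_; _,_; proj₁; proj₂; ∃)
open import Data.Sum using (_⊎_; inj₁; inj₂)
open import Data.Empty using (⊥)
open import Function using (_∘_; id)
open import Function.Bundles using (_⇔_)
open import Relation.Binary.PropositionalEquality using (_≡_)

module _ {r ℓr : Level} (R : Ring r ℓr) (m ℓm : Level) where

  open Ring R using () renaming (Carrier to |R|; _≈_ to _≈R_)

  Module : Set (r ⊔ ℓr ⊔ lsuc (m ⊔ ℓm))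
  Module = LeftModule R m ℓm

  Class : (p : Level) → Set (r ⊔ ℓr ⊔ lsuc (m ⊔ ℓm) ⊔ lsuc p)
  Class p = Module → Set p

  record Submodule (N : Module) : Set (r ⊔ lsuc m ⊔ ℓm) where
    open LeftModule N
    field
      _∈_   : Carrierᴹ → Set m
      ∈-resp : ∀ {x y} → x ≈ᴹ y → _∈_ x → _∈_ y
      0∈    : _∈_ 0ᴹ
      +∈    : ∀ {x y} → _∈_ x → _∈_ y → _∈_ (x +ᴹ y)
      -∈    : ∀ {x} → _∈_ x → _∈_ (-ᴹ x)
      *∈    : ∀ (a : |R|) {x} → _∈_ x → _∈_ (a *ₗ x)

  open Submodule public using (_∈_)

  Subset : Module → Set (lsuc m)
  Subset N = LeftModule.Carrierᴹ N → Set m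

  _⊆_ : {N : Module} → Subset N → Subset N → Set m
  A ⊆ B = ∀ x → A x → B x

  ⟦_⟧ : {N : Module} → Submodule N → Module
  ⟦_⟧ {N} S = record
    { Carrierᴹ = Σ Carrierᴹ (S ∈_)
    ; _≈ᴹ_ = λ x y → proj₁ x ≈ᴹ proj₁ y
    ; _+ᴹ_ = λ x y → (proj₁ x +ᴹ proj₁ y) , +∈ (proj₂ x) (proj₂ y)
    ; _*ₗ_ = λ a x → (a *ₗ proj₁ x) , *∈ a (proj₂ x)
    ; 0ᴹ = 0ᴹ , 0∈
    ; -ᴹ_ = λ x → (-ᴹ proj₁ x) , -∈ (proj₂ x)
    ; isLeftModule = LMM.isLeftModule mono (Ring.isRing R) (LeftModule.isLeftModule N)
    }
    where
      open LeftModule N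
      open Submodule S
      raw = record
        { Carrierᴹ = Σ Carrierᴹ (S ∈_)
        ; _≈ᴹ_ = λ x y → proj₁ x ≈ᴹ proj₁ y
        ; _+ᴹ_ = λ x y → (proj₁ x +ᴹ proj₁ y) , +∈ (proj₂ x) (proj₂ y)
        ; _*ₗ_ = λ a x → (a *ₗ proj₁ x) , *∈ a (proj₂ x)
        ; 0ᴹ = 0ᴹ , 0∈
        ; -ᴹ_ = λ x → (-ᴹ proj₁ x) , -∈ (proj₂ x)
        }
      open LeftModuleMorphisms raw rawLeftModule
      mono : IsLeftModuleMonomorphism proj₁
      mono = record
        { isLeftModuleHomomorphism = record
          { +ᴹ-isGroupHomomorphism = record
            { isMonoidHomomorphism = record
              { isMagmaHomomorphism = record
                { isRelHomomorphism = record { cong = id }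
                ; homo = λ _ _ → ≈ᴹ-refl }
              ; ε-homo = ≈ᴹ-refl }
            ; ⁻¹-homo = λ _ → ≈ᴹ-refl }
          ; *ₗ-homo = λ _ _ → ≈ᴹ-refl }
        ; injective = id }

  ∑ : (N : Module) {n : ℕ} → (Fin n → LeftModule.Carrierᴹ N) → LeftModule.Carrierᴹ N
  ∑ N {zero} f = LeftModule.0ᴹ N
  ∑ N {suc n} f = LeftModule._+ᴹ_ N (f zero) (∑ N (f ∘ suc))

  Solves : (N : Module) {k n : ℕ} → (Fin k → Fin n → |R|) → (Fin k → LeftModule.Carrierᴹ N)
         → (Fin n → LeftModule.Carrierᴹ N) → Set ℓm
  Solves N a b x = ∀ i → LeftModule._≈ᴹ_ N (∑ N (λ j → LeftModule._*ₗ_ N (a i j) (x j))) (b i)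

  PureIn : {N : Module} → Submodule N → Submodule N → Set (r ⊔ m ⊔ ℓm)
  PureIn {N} S T = ∀ (k n : ℕ) (a : Fin k → Fin n → |R|) (b : Fin k → LeftModule.Carrierᴹ N)
    → (∀ i → S ∈ b i)
    → Σ (Fin n → LeftModule.Carrierᴹ N) (λ x → (∀ j → T ∈ x j) × Solves N a b x)
    → Σ (Fin n → LeftModule.Carrierᴹ N) (λ x → (∀ j → S ∈ x j) × Solves N a b x)

  Whole : (N : Module) → Submodule N
  Whole N = record
    { _∈_ = λ _ → Lift⊤ ; ∈-resp = λ _ _ → lift-tt ; 0∈ = lift-tt
    ; +∈ = λ _ _ → lift-tt ; -∈ = λ _ → lift-tt ; *∈ = λ _ _ → lift-tt }
    where
      open import Data.Unit.Polymorphic using () renaming (⊤ to Lift⊤; tt to lift-tt)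

  Pure : {N : Module} → Submodule N → Set (r ⊔ m ⊔ ℓm)
  Pure {N} S = PureIn S (Whole N)

  module _ {p : Level} (K : Class p) where

    IsoClosed : Set (r ⊔ ℓr ⊔ lsuc (m ⊔ ℓm) ⊔ p)
    IsoClosed = ∀ (M M' : Module) → K M
      → (f : LeftModule.Carrierᴹ M → LeftModule.Carrierᴹ M')
      → LeftModuleMorphisms.IsLeftModuleIsomorphism
          (LeftModule.rawLeftModule M) (LeftModule.rawLeftModule M') f
      → K M'

    -- Tarski–Vaught chain axiom for (K, ≤_p): the union of a nonempty ≤_p-chain of members
    -- of K is in K (the chain is realised inside an ambient module N, e.g. the union itself)
    ChainClosed : Set (r ⊔ ℓr ⊔ lsuc (m ⊔ ℓm) ⊔ p)
    ChainClosed = ∀ (N : Module) (I : Set m) → I → (S : I → Submodule N)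
      → (∀ i j → ((_⊆_ {N} (S i ∈_) (S j ∈_)) × PureIn (S i) (S j))
                 ⊎ ((_⊆_ {N} (S j ∈_) (S i ∈_)) × PureIn (S j) (S i)))
      → (∀ i → K ⟦ S i ⟧)
      → (U : Submodule N) → (∀ x → (U ∈ x) ⇔ Σ I (λ i → S i ∈ x))
      → K ⟦ U ⟧

    -- Löwenheim–Skolem axiom: there is an infinite "cardinal" L (≥ |R| + ℵ₀) such that for all
    -- N ∈ K and A ⊆ N there is M ∈ K with A ⊆ M ≤_p N and |M| ≤ |A| + |L|
    LS : Set (r ⊔ ℓr ⊔ lsuc (m ⊔ ℓm) ⊔ p)
    LS = Σ (Set m) λ L →
         Σ (ℕ → L) (λ f → ∀ x y → f x ≡ f y → x ≡ y) ×
         Σ (|R| → L) (λ f → ∀ x y → f x ≡ f y → x ≈R y) ×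
         (∀ (N : Module) → K N → (A : Subset N) →
           Σ (Submodule N) λ M → (_⊆_ {N} A (M ∈_)) × K ⟦ M ⟧ × Pure M ×
             Σ (Σ (LeftModule.Carrierᴹ N) (M ∈_) → Σ (LeftModule.Carrierᴹ N) A ⊎ L)
               (λ g → ∀ x y → SameCode N A L (g x) (g y)
                     → LeftModule._≈ᴹ_ N (proj₁ x) (proj₁ y)))
      where
        SameCode : (N : Module) (A : Subset N) (L : Set m)
                 → Σ (LeftModule.Carrierᴹ N) A ⊎ L → Σ (LeftModule.Carrierᴹ N) A ⊎ L → Set (m ⊔ ℓm)
        SameCode N A L (inj₁ a) (inj₁ b) = Level.Lift (m ⊔ ℓm) (LeftModule._≈ᴹ_ N (proj₁ a) (proj₁ b))
        SameCode N A L (inj₂ a) (inj₂ b) = Level.Lift (m ⊔ ℓm) (a ≡ b)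
        SameCode N A L _ _ = Level.Lift (m ⊔ ℓm) ⊥

    -- (K, ≤_p) is an abstract elementary class.  (≤_p being a partial order, coherence, and the
    -- remaining chain clauses hold automatically for the pure-submodule relation.)
    record IsAEC : Set (r ⊔ ℓr ⊔ lsuc (m ⊔ ℓm) ⊔ p) where
      field
        isoClosed   : IsoClosed
        chainClosed : ChainClosed
        ls          : LS

    InCl : (N : Module) → Subset N → LeftModule.Carrierᴹ N → Set (r ⊔ lsuc m ⊔ ℓm ⊔ p)
    InCl N A x = ∀ (M : Submodule N) → K ⟦ M ⟧ → Pure M → _⊆_ {N} A (M ∈_) → M ∈ x

    AdmitsIntersections : Set (r ⊔ ℓr ⊔ lsuc (m ⊔ ℓm) ⊔ p)
    AdmitsIntersections = ∀ (N : Module) → K N → (A : Subset N) →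
      Σ (Submodule N) λ C → K ⟦ C ⟧ × Pure C × (∀ x → (C ∈ x) ⇔ InCl N A x)

    PureClosed : Set (r ⊔ ℓr ⊔ lsuc (m ⊔ ℓm) ⊔ p)
    PureClosed = ∀ (N : Module) → K N → (M : Submodule N) → Pure M → K ⟦ M ⟧

  ClosedBelow : {p q : Level} → Class q → Class p → Set (r ⊔ ℓr ⊔ lsuc (m ⊔ ℓm) ⊔ p ⊔ q)
  ClosedBelow K⋆ K = (∀ M → K⋆ M → K M) × PureClosed K × PureClosed K⋆ × AdmitsIntersections K

-- For N ∈ K⋆ every pure submodule of N lies in K⋆ ⊆ K, so the members of K and of K⋆ that are
-- pure in N coincide; hence so do the two intersections, and the K-closure, being pure in N,
-- is itself in K⋆.
module Submission where

open import Defs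
open import Level using (Level)
open import Algebra.Bundles using (Ring)
open import Data.Product using (_×_; _,_)
open import Function.Bundles using (_⇔_; mk⇔)
open import Function.Properties.Equivalence using () renaming (trans to ⇔-trans)

module _ {r ℓr m ℓm : Level} (R : Ring r ℓr) {p q : Level}
         {K : Class R m ℓm p} {K⋆ : Class R m ℓm q} where

  InCl-⇔-of-pureClosed-subclass : (∀ M → K⋆ M → K M) → PureClosed R m ℓm K⋆
    → ∀ (N : Module R m ℓm) → K⋆ N → (A : Subset R m ℓm N)
    → ∀ x → InCl R m ℓm K N A x ⇔ InCl R m ℓm K⋆ N A x
  InCl-⇔-of-pureClosed-subclass K⋆⊆K pcK⋆ N N⋆ A x = mk⇔
    (λ x∈clK M M⋆ M≤N A⊆M → x∈clK M (K⋆⊆K _ M⋆) M≤N A⊆M)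
    (λ x∈clK⋆ M _ M≤N A⊆M → x∈clK⋆ M (pcK⋆ N N⋆ M M≤N) M≤N A⊆M)

  admitsIntersections-of-pureClosed-subclass : (∀ M → K⋆ M → K M) → PureClosed R m ℓm K⋆
    → AdmitsIntersections R m ℓm K → AdmitsIntersections R m ℓm K⋆
  admitsIntersections-of-pureClosed-subclass K⋆⊆K pcK⋆ admK N N⋆ A
    with admK N (K⋆⊆K N N⋆) A
  ... | C , _ , C≤N , C≡clK =
    C , pcK⋆ N N⋆ C C≤N , C≤N ,
    λ x → ⇔-trans (C≡clK x) (InCl-⇔-of-pureClosed-subclass K⋆⊆K pcK⋆ N N⋆ A x)

proposition5p5 : ∀ {r ℓr m ℓm p q : Level} (R : Ring r ℓr)
    (K : Class R m ℓm p) (K⋆ : Class R m ℓm q)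
    → IsAEC R m ℓm K → IsAEC R m ℓm K⋆
    → ClosedBelow R m ℓm K⋆ K
    → AdmitsIntersections R m ℓm K⋆
    × (∀ (N : Module R m ℓm) → K⋆ N → (A : Subset R m ℓm N)
    → ∀ x → InCl R m ℓm K N A x ⇔ InCl R m ℓm K⋆ N A x)
proposition5p5 R K K⋆ _ _ (K⋆⊆K , _ , pcK⋆ , admK) =
  admitsIntersections-of-pureClosed-subclass R K⋆⊆K pcK⋆ admK ,
  InCl-⇔-of-pureClosed-subclass R K⋆⊆K pcK⋆
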